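{- For integers $a\ge b\ge0$ let $h(a,b)=\mathcal{N}_b(\mathcal{G}_a\cap\mathcal{D})$. Then for every integer $i$ with $0\le i\le b$, $h(a-i,b-i)\le h(a,b)$.
   Context: For a graph $H$, $\omega(H)$ is its clique number and $\bar\Delta(H)$ its maximum missing degree (the maximum degree of the complement of $H$). $\mathcal{D}$ is the family of graphs $H$ with $|V(H)|\ge\omega(H)+2\bar\Delta(H)^2+2$ or $\bar\Delta(H)\le1$. $\mathcal{G}_s$ is the family of graphs $H$ with $\lfloor(|V(H)|+\omega(H))/2\rfloor\le s-1$. For a family $\mathcal{F}$ and integer $j\ge0$, $\mathcal{N}_j(\mathcal{F})$ is the maximum number of cliques of order $j$ in a graph of $\mathcal{F}$ (a graph has exactly one clique of order $0$). -}

module Defs where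

open import Data.Nat using (ℕ; zero; suc; _+_; _*_; _≤_; _<_; _⊔_; ⌊_/2⌋)
open import Data.Nat.Properties using (_≟_)
open import Data.Bool using (Bool; true; false)
open import Data.Bool.Properties using () renaming (_≟_ to _≟ᵇ_)
open import Data.Fin using (Fin) renaming (_≟_ to _≟ᶠ_)
open import Data.Fin.Properties using (all?)
open import Data.Fin.Subset using (Subset; inside; outside; _∈_; ∣_∣)
open import Data.Fin.Subset.Properties using (_∈?_)
open import Data.List using (List; []; _∷_; _++_; map; filter; length; foldr)
open import Data.Vec using (_∷_; [])
open import Data.Product using (Σ; ∃; _×_; _,_)
open import Data.Sum using (_⊎_)
open import Relation.Nullary using (¬_; Dec; yes; no)
open import Relation.Nullary.Decidable using (_×-dec_; ¬?; _→-dec_)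
open import Relation.Binary.PropositionalEquality using (_≡_; _≢_)

record Graph : Set where
  field
    n      : ℕ
    adj    : Fin n → Fin n → Bool
    sym    : ∀ x y → adj x y ≡ adj y x
    irrefl : ∀ x → adj x x ≡ false
open Graph public

subsets : (m : ℕ) → List (Subset m)
subsets zero    = [] ∷ []
subsets (suc m) = map (inside ∷_) (subsets m) ++ map (outside ∷_) (subsets m)

IsClique : (H : Graph) → Subset (n H) → Set
IsClique H S = ∀ x y → x ∈ S → y ∈ S → x ≢ y → adj H x y ≡ true

isClique? : (H : Graph) → (S : Subset (n H)) → Dec (IsClique H S)
isClique? H S = all? λ x → all? λ y →
  (x ∈? S) →-dec ((y ∈? S) →-dec ((¬? (x ≟ᶠ y)) →-dec (adj H x y ≟ᵇ true)))

cliques : (H : Graph) → List (Subset (n H))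
cliques H = filter (isClique? H) (subsets (n H))

-- Number of cliques of order j in H (exactly one clique of order 0: the empty set).
cliqueCount : Graph → ℕ → ℕ
cliqueCount H j = length (filter (λ S → ∣ S ∣ ≟ j) (cliques H))

maxList : List ℕ → ℕ
maxList = foldr _⊔_ 0

ω : Graph → ℕ
ω H = maxList (map ∣_∣ (cliques H))

missingDeg : (H : Graph) → Fin (n H) → ℕ
missingDeg H v = length (filter (λ u → ¬? (u ≟ᶠ v) ×-dec (adj H u v ≟ᵇ false)) (Data.List.allFin (n H)))

-- Maximum missing degree Δ̄(H) (0 for the graph with no vertices).
Δ̄ : Graph → ℕ
Δ̄ H = maxList (map (missingDeg H) (Data.List.allFin (n H)))

InD : Graph → Set
InD H = (ω H + 2 * (Δ̄ H * Δ̄ H) + 2 ≤ n H) ⊎ (Δ̄ H ≤ 1)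

-- The family 𝒢_s : ⌊(|V(H)| + ω(H))/2⌋ ≤ s - 1 (over ℤ), i.e. < s.
InG : ℕ → Graph → Set
InG s H = ⌊ n H + ω H /2⌋ < s

InGD : ℕ → Graph → Set
InGD s H = InG s H × InD H

-- N_j(F) ≤ N_k(F') for graph families F, F' (given as predicates), unfolded:
-- every graph in F with c cliques of order j is matched by a graph in F'
-- with at least c cliques of order k.  (Both maxima exist whenever the
-- families are nonempty, since 𝒢_s is finite up to isomorphism.)
NLe : (Graph → Set) → ℕ → (Graph → Set) → ℕ → Set
NLe F j F' k = ∀ H → F H → ∃ λ H' → F' H' × cliqueCount H j ≤ cliqueCount H' k

-- h(a,b) = N_b(𝒢_a ∩ 𝒟);  hLe a b a' b'  means  h(a,b) ≤ h(a',b').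
hLe : ℕ → ℕ → ℕ → ℕ → Set
hLe a b a' b' = NLe (InGD a) b (InGD a') b'

{-# OPTIONS --safe #-}
module Submission where

-- Adding a universal vertex (the cone over H) raises the number of vertices by one and
-- the clique number by at most one, and does not raise the maximum missing degree; so
-- it maps 𝒢_s ∩ 𝒟 into 𝒢_(s+1) ∩ 𝒟, while every j-clique of H together with the apex
-- is a (j+1)-clique of the cone.  Hence h(s,j) ≤ h(s+1,j+1); iterate i times.

open import Defs
open import Data.Nat using (ℕ; _≤_; _∸_; zero; suc; _+_; ⌊_/2⌋; z≤n; s≤s)
open import Data.Nat.Properties
  using ( ≤-refl; ≤-reflexive; ≤-trans; n≤1+n; ⊔-lub; m≤m⊔n; m≤n⊔m; +-suc; ⌊n/2⌋-mono
        ; +-monoˡ-≤; +-monoʳ-≤; +-mono-≤; *-monoʳ-≤; *-mono-≤; m+[n∸m]≡n; module ≤-Reasoning)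
open import Data.Bool using (Bool; true; false)
open import Data.Fin using (Fin; zero; suc)
open import Data.Fin.Properties using (suc-injective)
open import Data.Fin.Subset using (Subset; inside; outside; ∣_∣)
open import Data.Vec using (_∷_; []; there)
open import Data.List using ([]; _∷_; map; allFin; tabulate; length)
open import Data.List.Properties using (filter-none)
open import Data.List.Membership.Propositional using (_∈_)
open import Data.List.Membership.Propositional.Properties
  using (∈-filter⁺; ∈-filter⁻; ∈-map⁺; ∈-++⁺ˡ; ∈-++⁺ʳ; ∈-allFin)
open import Data.List.Relation.Unary.All as All using (All)
open import Data.List.Relation.Unary.All.Properties as All using ()
open import Data.List.Relation.Unary.Any using (here; there)
open import Data.List.Relation.Binary.Pointwise as Pointwise using (Pointwise)
open import Data.List.Relation.Binary.Sublist.Heterogeneous using (Sublist; []; _∷_)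
open import Data.List.Relation.Binary.Sublist.Heterogeneous.Properties
  using (length-mono-≤; ⊆-filter-Sublist; ++ʳ; fromPointwise)
open import Data.Product using (_×_; _,_; proj₂)
open import Data.Sum using (inj₁; inj₂)
open import Data.Empty using (⊥-elim)
open import Relation.Binary.PropositionalEquality using (_≡_; _≢_; refl; cong; subst₂)
open import Relation.Nullary using (¬_)

maxList-≤ : ∀ {m xs} → All (_≤ m) xs → maxList xs ≤ m
maxList-≤ All.[]         = z≤n
maxList-≤ (x≤m All.∷ xs) = ⊔-lub x≤m (maxList-≤ xs)

≤-maxList : ∀ {x xs} → x ∈ xs → x ≤ maxList xs
≤-maxList {xs = y ∷ ys} (here refl) = m≤m⊔n y (maxList ys)
≤-maxList {xs = y ∷ ys} (there x∈) = ≤-trans (≤-maxList x∈) (m≤n⊔m y (maxList ys))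

∈-subsets : ∀ {m} (S : Subset m) → S ∈ subsets m
∈-subsets []           = here refl
∈-subsets (true ∷ S)   = ∈-++⁺ˡ (∈-map⁺ (inside ∷_) (∈-subsets S))
∈-subsets (false ∷ S)  = ∈-++⁺ʳ (map (inside ∷_) (subsets _)) (∈-map⁺ (outside ∷_) (∈-subsets S))

∣x∷p∣≤1+∣p∣ : ∀ {m} x (p : Subset m) → ∣ x ∷ p ∣ ≤ suc ∣ p ∣
∣x∷p∣≤1+∣p∣ true  p = ≤-refl
∣x∷p∣≤1+∣p∣ false p = n≤1+n ∣ p ∣

module _ (H : Graph) where

  ∣clique∣≤ω : ∀ {S} → IsClique H S → ∣ S ∣ ≤ ω H
  ∣clique∣≤ω {S} c = ≤-maxList (∈-map⁺ ∣_∣ (∈-filter⁺ (isClique? H) (∈-subsets S) c))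

  ω-≤ : ∀ {m} → (∀ S → IsClique H S → ∣ S ∣ ≤ m) → ω H ≤ m
  ω-≤ bound = maxList-≤ (All.map⁺ (All.tabulate λ {S} S∈ →
    bound S (proj₂ (∈-filter⁻ (isClique? H) {xs = subsets (n H)} S∈))))

  missingDeg≤Δ̄ : ∀ v → missingDeg H v ≤ Δ̄ H
  missingDeg≤Δ̄ v = ≤-maxList (∈-map⁺ (missingDeg H) (∈-allFin v))

  Δ̄-≤ : ∀ {m} → (∀ v → missingDeg H v ≤ m) → Δ̄ H ≤ m
  Δ̄-≤ bound = maxList-≤ (All.map⁺ (All.tabulate⁺ bound))

module Cone (H : Graph) where

  adjᶜ : Fin (suc (n H)) → Fin (suc (n H)) → Bool
  adjᶜ zero    zero    = false
  adjᶜ zero    (suc y) = true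
  adjᶜ (suc x) zero    = true
  adjᶜ (suc x) (suc y) = adj H x y

  cone : Graph
  cone = record { n = suc (n H) ; adj = adjᶜ ; sym = symᶜ ; irrefl = irreflᶜ }
    where
    symᶜ : ∀ x y → adjᶜ x y ≡ adjᶜ y x
    symᶜ zero    zero    = refl
    symᶜ zero    (suc y) = refl
    symᶜ (suc x) zero    = refl
    symᶜ (suc x) (suc y) = Graph.sym H x y

    irreflᶜ : ∀ x → adjᶜ x x ≡ false
    irreflᶜ zero    = refl
    irreflᶜ (suc x) = irrefl H x

  isClique-cone⁺ : ∀ {S} → IsClique H S → IsClique cone (inside ∷ S)
  isClique-cone⁺ c zero    zero    _          _          x≢y = ⊥-elim (x≢y refl)
  isClique-cone⁺ c zero    (suc y) _          _          _   = refl
  isClique-cone⁺ c (suc x) zero    _          _          _   = refl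
  isClique-cone⁺ c (suc x) (suc y) (there x∈) (there y∈) x≢y = c x y x∈ y∈ (λ x≡y → x≢y (cong suc x≡y))

  isClique-cone⁻ : ∀ {b S} → IsClique cone (b ∷ S) → IsClique H S
  isClique-cone⁻ c x y x∈ y∈ x≢y = c (suc x) (suc y) (there x∈) (there y∈) (λ e → x≢y (suc-injective e))

  ω-cone : ω cone ≤ suc (ω H)
  ω-cone = ω-≤ cone λ { (b ∷ S) c → ≤-trans (∣x∷p∣≤1+∣p∣ b S) (s≤s (∣clique∣≤ω H (isClique-cone⁻ c))) }

  -- In this lemma and the next, the filter discards vertex zero by computation, so only
  -- the vertices in tabulate suc remain to be examined.
  missingDeg-apex : missingDeg cone zero ≡ 0
  missingDeg-apex = cong length (filter-none _ apex-adjacent)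
    where
    apex-adjacent : All (λ u → ¬ (u ≢ zero × adjᶜ u zero ≡ false)) (tabulate {n = n H} suc)
    apex-adjacent = All.tabulate⁺ λ { _ (_ , ()) }

  missingDeg-cone-suc : ∀ v → missingDeg cone (suc v) ≤ missingDeg H v
  missingDeg-cone-suc v = length-mono-≤ (⊆-filter-Sublist _ _
    (λ { refl (u≢v , nonadj) → (λ u≡v → u≢v (cong suc u≡v)) , nonadj })
    (fromPointwise shift))
    where
    shift : Pointwise (λ u′ u → u′ ≡ suc u) (tabulate suc) (allFin (n H))
    shift = Pointwise.tabulate⁺ λ _ → refl

  Δ̄-cone : Δ̄ cone ≤ Δ̄ H
  Δ̄-cone = Δ̄-≤ cone λ
    { zero    → ≤-trans (≤-reflexive missingDeg-apex) z≤n
    ; (suc v) → ≤-trans (missingDeg-cone-suc v) (missingDeg≤Δ̄ H v)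
    }

  subsets-⊆-inside : Sublist (λ S T → T ≡ inside ∷ S) (subsets (n H)) (subsets (n cone))
  subsets-⊆-inside = ++ʳ _ (prepend (subsets (n H)))
    where
    prepend : ∀ Ss → Sublist (λ S T → T ≡ inside ∷ S) Ss (map (inside ∷_) Ss)
    prepend []       = []
    prepend (S ∷ Ss) = refl ∷ prepend Ss

  cliqueCount-cone : ∀ j → cliqueCount H j ≤ cliqueCount cone (suc j)
  cliqueCount-cone j = length-mono-≤ (⊆-filter-Sublist _ _ (λ { refl → cong suc })
    (⊆-filter-Sublist _ _ (λ { refl → isClique-cone⁺ }) subsets-⊆-inside))

  InG-cone : ∀ {s} → InG s H → InG (suc s) cone
  InG-cone {s} g = begin-strict
    ⌊ suc (n H) + ω cone /2⌋      ≤⟨ ⌊n/2⌋-mono (+-monoʳ-≤ (suc (n H)) ω-cone) ⟩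
    ⌊ suc (n H) + suc (ω H) /2⌋   ≡⟨ cong ⌊_/2⌋ (cong suc (+-suc (n H) (ω H))) ⟩
    suc ⌊ n H + ω H /2⌋           <⟨ s≤s g ⟩
    suc s                         ∎
    where open ≤-Reasoning

  InD-cone : InD H → InD cone
  InD-cone (inj₁ dense) = inj₁ (≤-trans
    (+-monoˡ-≤ 2 (+-mono-≤ ω-cone (*-monoʳ-≤ 2 (*-mono-≤ Δ̄-cone Δ̄-cone))))
    (s≤s dense))
  InD-cone (inj₂ Δ̄≤1) = inj₂ (≤-trans Δ̄-cone Δ̄≤1)

open Cone

NLe-refl : ∀ {F j} → NLe F j F j
NLe-refl H FH = H , FH , ≤-refl

NLe-trans : ∀ {F F′ F″ j k l} → NLe F j F′ k → NLe F′ k F″ l → NLe F j F″ l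
NLe-trans F≤F′ F′≤F″ H FH with F≤F′ H FH
... | H′ , F′H′ , c≤c′ with F′≤F″ H′ F′H′
... | H″ , F″H″ , c′≤c″ = H″ , F″H″ , ≤-trans c≤c′ c′≤c″

hLe-suc : ∀ s j → hLe s j (suc s) (suc j)
hLe-suc s j H (g , d) = cone H , (InG-cone H g , InD-cone H d) , cliqueCount-cone H j

hLe-+ : ∀ k s j → hLe s j (k + s) (k + j)
hLe-+ zero    s j = NLe-refl
hLe-+ (suc k) s j = NLe-trans (hLe-+ k s j) (hLe-suc (k + s) (k + j))

lemma3p13 : (a b : ℕ) → b ≤ a → (i : ℕ) → i ≤ b → hLe (a ∸ i) (b ∸ i) a b
lemma3p13 a b b≤a i i≤b =
  subst₂ (hLe (a ∸ i) (b ∸ i)) (m+[n∸m]≡n (≤-trans i≤b b≤a)) (m+[n∸m]≡n i≤b) (hLe-+ i (a ∸ i) (b ∸ i))
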